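{- Let $(G,T;A,B)$ be a quasicomb and $F$ a minimum join. Let $x,y\in V(G)$ and let $P$ be a path between $x$ and $y$. (i) If $x,y\in A$, then $P$ is $F$-balanced if and only if $w_F(P)=0$. (ii) Let $x\in A$ and $y\in B$. (a) If $P$ is $F$-balanced then $w_F(P)\in\{1,-1\}$. (b) $w_F(P)=-1$ if and only if $P$ is $F$-balanced and the edge of $P$ incident to $y$ is in $F$. (c) If $P$ is $F$-balanced, then $w_F(P)=1$ if and only if the edge of $P$ incident to $y$ is not in $F$. (iii) Let $x,y\in B$. (a) If $P$ is $F$-balanced then $w_F(P)\in\{ -2,0,2\}$. (b) $w_F(P)=-2$ if and only if $P$ is $F$-balanced and the edges of $P$ incident to its ends are in $F$. (c) If $P$ is $F$-balanced, then $w_F(P)=0$ if and only if, of the two edges of $P$ incident to its ends, one is in $F$ and the other is not; and $w_F(P)=2$ if and only if neither of the edges of $P$ incident to its ends is in $F$.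
   Context: Graphs are finite, possibly with multiple edges. A join of $(G,T)$ is $F\subseteq E(G)$ with $|\delta_G(v)\cap F|$ odd iff $v\in T$; $\nu(G,T)$ is the minimum join size. $(G,T;A,B)$ is a bipartite graft with ordered color classes $A,B$; quasicomb: $\nu(G,T)=|B\cap T|$. $w_F(e)=-1$ for $e\in F$, $1$ otherwise; $w_F(P)$ is the sum over the edges of $P$. A path $P$ with ends $s,t$ is $F$-balanced if $|\delta_P(v)\cap F|=1$ for every $v\in(V(P)\cap B)\setminus\{s,t\}$. -}

module Defs where

open import Data.Nat using (ℕ; zero; suc; _+_; _≤_; _%_)
open import Data.Integer using (ℤ; +_; -[1+_]; -_) renaming (_+_ to _+ᶻ_)
open import Data.Fin using (Fin; zero; suc; toℕ; inject₁)
open import Data.Fin.Subset using (Subset)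
open import Data.Vec using (lookup)
open import Data.Bool using (Bool; true; false; if_then_else_; _∧_; not)
open import Data.Product using (Σ; _×_; _,_; proj₁; proj₂; Σ-syntax)
open import Data.Sum using (_⊎_)
open import Relation.Binary.PropositionalEquality using (_≡_; _≢_)
open import Relation.Nullary using (does)
open import Data.Fin using (_≟_)
open import Function.Definitions using (Injective)

count : (k : ℕ) → (Fin k → Bool) → ℕ
count zero    p = 0
count (suc k) p = (if p zero then 1 else 0) + count k (λ i → p (suc i))

sumℤ : (k : ℕ) → (Fin k → ℤ) → ℤ
sumℤ zero    f = + 0
sumℤ (suc k) f = f zero +ᶻ sumℤ k (λ i → f (suc i))

b2n : Bool → ℕ
b2n true  = 1
b2n false = 0

-- A bipartite graft (G,T;A,B): colour classes A = {v | inA v ≡ true},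
-- B = {v | inA v ≡ false}; every edge joins A and B.
record BipGraft : Set where
  field
    n     : ℕ
    m     : ℕ
    ends  : Fin m → Fin n × Fin n
    T     : Subset n
    inA   : Fin n → Bool
    bipartite : ∀ e → inA (proj₁ (ends e)) ≢ inA (proj₂ (ends e))

module _ (Γ : BipGraft) where
  open BipGraft Γ

  incident : Fin n → Fin m → Bool
  incident v e = does (v ≟ proj₁ (ends e)) Data.Bool.∨ does (v ≟ proj₂ (ends e))

  degIn : Subset m → Fin n → ℕ
  degIn F v = count m (λ e → incident v e ∧ lookup F e)

  IsJoin : Subset m → Set
  IsJoin F = ∀ v → (degIn F v % 2 ≡ 1 → lookup T v ≡ true)
                 × (lookup T v ≡ true → degIn F v % 2 ≡ 1)

  size : Subset m → ℕ
  size F = count m (lookup F)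

  NuIs : ℕ → Set
  NuIs k = (Σ[ F ∈ Subset m ] (IsJoin F × size F ≡ k))
         × (∀ F → IsJoin F → k ≤ size F)

  IsMinJoin : Subset m → Set
  IsMinJoin F = IsJoin F × (∀ F' → IsJoin F' → size F ≤ size F')

  sizeBT : ℕ
  sizeBT = count n (λ v → not (inA v) ∧ lookup T v)

  Quasicomb : Set
  Quasicomb = NuIs sizeBT

  record Path (x y : Fin n) : Set where
    field
      len   : ℕ
      vs    : Fin (suc len) → Fin n
      es    : Fin len → Fin m
      vsInj : Injective _≡_ _≡_ vs
      link  : ∀ i → (ends (es i) ≡ (vs (inject₁ i) , vs (suc i)))
                    ⊎ (ends (es i) ≡ (vs (suc i) , vs (inject₁ i)))
      start : vs zero ≡ x
      stop  : ∀ (j : Fin (suc len)) → toℕ j ≡ len → vs j ≡ y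

  module _ (F : Subset m) {x y : Fin n} (P : Path x y) where
    open Path P

    wF : Fin m → ℤ
    wF e = if lookup F e then -[1+ 0 ] else + 1

    weight : ℤ
    weight = sumℤ len (λ i → wF (es i))

    -- F-balanced: each internal vertex vs (i+1) (between edges es i and
    -- es j, j = i+1) lying in B has exactly one incident path edge in F.
    -- (Internal vertices are exactly those ≠ ends, by injectivity of vs.)
    Balanced : Set
    Balanced = ∀ (i j : Fin len) → toℕ j ≡ suc (toℕ i) → inA (vs (suc i)) ≡ false
             → b2n (lookup F (es i)) + b2n (lookup F (es j)) ≡ 1

    FirstEdgeIs : Bool → Set
    FirstEdgeIs b = Σ[ i ∈ Fin len ] (toℕ i ≡ 0 × lookup F (es i) ≡ b)

    LastEdgeIs : Bool → Set
    LastEdgeIs b = Σ[ i ∈ Fin len ] (suc (toℕ i) ≡ len × lookup F (es i) ≡ b)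

-- Every edge has exactly one end in B, so for a join F the sum over v ∈ B of
-- |δ(v) ∩ F| is |F|, while each v ∈ B ∩ T contributes at least 1.  In a
-- quasicomb a minimum join has |F| = |B ∩ T|, so no vertex of B meets two
-- edges of F.  Along a path the colours alternate, so the two path edges at an
-- inner B-vertex weigh 0 together if exactly one is in F (the vertex is
-- balanced) and 2 if neither is.  Hence w_F(P) is twice the number of
-- unbalanced inner B-vertices plus ±1 for each end edge at an end in B, and all
-- three parts are read off from this formula.

{-# OPTIONS --safe #-}
module Submission where

open import Defs
open import Data.Bool using (Bool; true; false; not; _∧_; _∨_; if_then_else_)
open import Data.Bool.Properties using (¬-not; ∨-identityʳ; ∧-comm)
open import Data.Integer using (ℤ; +_; -[1+_]) renaming (_+_ to _+ᶻ_)
import Data.Integer.Properties as ℤ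
open import Data.Fin using (Fin; zero; suc; toℕ; inject₁; fromℕ; _≟_)
open import Data.Fin.Properties using (toℕ-injective; toℕ-fromℕ; toℕ-inject₁)
open import Data.Fin.Subset using (Subset)
open import Data.Nat using (ℕ; zero; suc; _+_; _*_; _≤_; _<_; z≤n; s≤s; _%_)
open import Data.Nat.Properties
  using (module ≤-Reasoning; +-0-commutativeMonoid; +-mono-≤; +-mono-<-≤; +-mono-≤-<; m≤n+m; ≤-trans;
         ≤-<-trans; <⇒≱; m+n≡0⇒m≡0; m+n≡0⇒n≡0; *-distribˡ-+; *-suc; m≢1+n+m; suc-injective)
open import Algebra.Properties.CommutativeMonoid.Sum +-0-commutativeMonoid
  using (sum; sum-cong-≗; ∑-comm; sum-replicate-zero)
open import Data.Vec using (lookup)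
open import Data.Product using (_×_; _,_; proj₁; proj₂; Σ-syntax)
open import Data.Product.Function.NonDependent.Propositional using (_×-⇔_)
open import Data.Sum using (_⊎_; inj₁; inj₂)
import Data.Sum as Sum
open import Data.Sum.Function.Propositional using (_⊎-⇔_)
open import Data.Empty using (⊥; ⊥-elim)
open import Function.Base using (_∘_)
open import Function.Bundles using (_⇔_; mk⇔; Equivalence)
open import Function.Properties.Equivalence using () renaming (trans to ⇔-trans; sym to ⇔-sym)
open import Relation.Binary.PropositionalEquality
open import Relation.Nullary using (does; yes; no; contradiction)
open import Relation.Nullary.Decidable using (dec-true; dec-false)

open Equivalence using (to; from)

count≡sum : ∀ k (p : Fin k → Bool) → count k p ≡ sum (b2n ∘ p)
count≡sum zero    p = refl
count≡sum (suc k) p = cong₂ _+_ (if-b2n (p zero)) (count≡sum k (p ∘ suc))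
  where
  if-b2n : ∀ b → (if b then 1 else 0) ≡ b2n b
  if-b2n true  = refl
  if-b2n false = refl

count-cong : ∀ k {p q : Fin k → Bool} → (∀ i → p i ≡ q i) → count k p ≡ count k q
count-cong k {p} {q} p≗q =
  trans (count≡sum k p) (trans (sum-cong-≗ (cong b2n ∘ p≗q)) (sym (count≡sum k q)))

count-one : ∀ k (p : Fin k → Bool) i → p i ≡ true → 1 ≤ count k p
count-one (suc k) p zero    pi rewrite pi = s≤s z≤n
count-one (suc k) p (suc i) pi = ≤-trans (count-one k (p ∘ suc) i pi) (m≤n+m _ _)

count-two : ∀ k (p : Fin k → Bool) i j → i ≢ j → p i ≡ true → p j ≡ true → 2 ≤ count k p
count-two (suc k) p zero    zero    i≢j _  _  = contradiction refl i≢j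
count-two (suc k) p zero    (suc j) _   pi pj rewrite pi = s≤s (count-one k (p ∘ suc) j pj)
count-two (suc k) p (suc i) zero    _   pi pj rewrite pj = s≤s (count-one k (p ∘ suc) i pi)
count-two (suc k) p (suc i) (suc j) i≢j pi pj =
  ≤-trans (count-two k (p ∘ suc) i j (i≢j ∘ cong suc) pi pj) (m≤n+m _ _)

sum-mono-≤ : ∀ {k} {g h : Fin k → ℕ} → (∀ i → g i ≤ h i) → sum g ≤ sum h
sum-mono-≤ {zero}  g≤h = z≤n
sum-mono-≤ {suc k} g≤h = +-mono-≤ (g≤h zero) (sum-mono-≤ (g≤h ∘ suc))

sum-mono-< : ∀ {k} {g h : Fin k → ℕ} → (∀ i → g i ≤ h i) → ∀ i → g i < h i → sum g < sum h
sum-mono-< g≤h zero    g<h = +-mono-<-≤ g<h (sum-mono-≤ (g≤h ∘ suc))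
sum-mono-< g≤h (suc i) g<h = +-mono-≤-< (g≤h zero) (sum-mono-< (g≤h ∘ suc) i g<h)

sum-δ : ∀ {k} (u : Fin k) → sum (λ v → b2n (does (v ≟ u))) ≡ 1
sum-δ {suc k} zero    = cong suc (sum-replicate-zero k)
sum-δ {suc k} (suc u) = sum-δ u

sum-δ-∧ : ∀ {k} b (u : Fin k) → sum (λ v → b2n (b ∧ does (v ≟ u))) ≡ b2n b
sum-δ-∧     true  u = sum-δ u
sum-δ-∧ {k} false u = sum-replicate-zero k

sum-count-fibres : ∀ {k n} (h : Fin k → Fin n) (p : Fin k → Bool)
  → sum (λ u → count k (λ i → p i ∧ does (u ≟ h i))) ≡ count k p
sum-count-fibres {k} h p = begin
  sum (λ u → count k (λ i → p i ∧ does (u ≟ h i)))   ≡⟨ sum-cong-≗ (λ u → count≡sum k (λ i → p i ∧ does (u ≟ h i))) ⟩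
  sum (λ u → sum (λ i → b2n (p i ∧ does (u ≟ h i)))) ≡⟨ ∑-comm (λ u i → b2n (p i ∧ does (u ≟ h i))) ⟩
  sum (λ i → sum (λ u → b2n (p i ∧ does (u ≟ h i)))) ≡⟨ sum-cong-≗ (λ i → sum-δ-∧ (p i) (h i)) ⟩
  sum (b2n ∘ p)                                      ≡⟨ count≡sum k p ⟨
  count k p                                          ∎
  where open ≡-Reasoning

-- Alternating sequences

-- A path of length k is abstracted to the colours c of its vertices
-- (true for A) and the F-membership f of its edges.  At c = inA ∘ vs and
-- f = lookup F ∘ es, weight, Balanced, FirstEdgeIs and LastEdgeIs unfold to
-- weightSeq, BalancedAtB, FirstIs and LastIs.

w : Bool → ℤ
w b = if b then -[1+ 0 ] else + 1

weightSeq : ∀ k → (Fin k → Bool) → ℤ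
weightSeq k f = sumℤ k (w ∘ f)

Alternating : ∀ k → (Fin (suc k) → Bool) → Set
Alternating k c = ∀ i → c (suc i) ≡ not (c (inject₁ i))

BalancedAtB : ∀ k → (Fin (suc k) → Bool) → (Fin k → Bool) → Set
BalancedAtB k c f = ∀ (i j : Fin k) → toℕ j ≡ suc (toℕ i) → c (suc i) ≡ false
                  → b2n (f i) + b2n (f j) ≡ 1

NoDoubleAtB : ∀ k → (Fin (suc k) → Bool) → (Fin k → Bool) → Set
NoDoubleAtB k c f = ∀ (i j : Fin k) → toℕ j ≡ suc (toℕ i) → c (suc i) ≡ false
                  → f i ≡ true → f j ≡ true → ⊥

FirstIs : ∀ k → (Fin k → Bool) → Bool → Set
FirstIs k f b = Σ[ i ∈ Fin k ] (toℕ i ≡ 0 × f i ≡ b)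

LastIs : ∀ k → (Fin k → Bool) → Bool → Set
LastIs k f b = Σ[ i ∈ Fin k ] (suc (toℕ i) ≡ k × f i ≡ b)

emptyPair : Bool → Bool → ℕ
emptyPair b b' = b2n (not (b ∨ b'))

-- For a path starting in A, the pairs (f 0, f 1), (f 2, f 3), … are the two
-- edges at its inner B-vertices.
emptyPairs : ∀ k → (Fin k → Bool) → ℕ
emptyPairs zero          f = 0
emptyPairs (suc zero)    f = 0
emptyPairs (suc (suc k)) f = emptyPair (f zero) (f (suc zero)) + emptyPairs k (λ i → f (suc (suc i)))

firstIs⇔ : ∀ {k} (f : Fin (suc k) → Bool) b → FirstIs (suc k) f b ⇔ f zero ≡ b
firstIs⇔ f b = mk⇔ (λ { (zero , _ , fb) → fb ; (suc _ , () , _) }) (λ fb → zero , refl , fb)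

lastIs⇔ : ∀ k (f : Fin (suc k) → Bool) b → LastIs (suc k) f b ⇔ f (fromℕ k) ≡ b
lastIs⇔ k f b = mk⇔ (λ { (i , i≡k , fb) → subst (λ i → f i ≡ b) (isLast i≡k) fb })
                    (λ fb → fromℕ k , cong suc (toℕ-fromℕ k) , fb)
  where
  isLast : ∀ {i} → suc (toℕ i) ≡ suc k → i ≡ fromℕ k
  isLast i≡k = toℕ-injective (trans (suc-injective i≡k) (sym (toℕ-fromℕ k)))

alternating-tail : ∀ {k} {c : Fin (suc (suc k)) → Bool} → Alternating (suc k) c → Alternating k (c ∘ suc)
alternating-tail alt = alt ∘ suc

noDoubleAtB-tail : ∀ {k} {c : Fin (suc (suc k)) → Bool} {f : Fin (suc k) → Bool}
  → NoDoubleAtB (suc k) c f → NoDoubleAtB k (c ∘ suc) (f ∘ suc)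
noDoubleAtB-tail nd i j j≡1+i = nd (suc i) (suc j) (cong suc j≡1+i)

balancedAtB-step : ∀ {k} {c : Fin (suc (suc (suc k))) → Bool} {f : Fin (suc (suc k)) → Bool}
  → BalancedAtB (suc (suc k)) c f
    ⇔ ((c (suc zero) ≡ false → b2n (f zero) + b2n (f (suc zero)) ≡ 1)
       × BalancedAtB (suc k) (c ∘ suc) (f ∘ suc))
balancedAtB-step {k} {c} {f} = mk⇔
  (λ bal → bal zero (suc zero) refl , λ i j j≡1+i → bal (suc i) (suc j) (cong suc j≡1+i))
  from-parts
  where
  from-parts : (c (suc zero) ≡ false → b2n (f zero) + b2n (f (suc zero)) ≡ 1)
               × BalancedAtB (suc k) (c ∘ suc) (f ∘ suc)
             → BalancedAtB (suc (suc k)) c f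
  from-parts (first , rest) zero    (suc zero)    _       c₁ = first c₁
  from-parts (first , rest) (suc i) (suc j)       j≡1+i   c₁ = rest i j (suc-injective j≡1+i) c₁
  from-parts (first , rest) zero    zero          ()
  from-parts (first , rest) zero    (suc (suc j)) ()
  from-parts (first , rest) (suc i) zero          ()

balancedAtB-drop : ∀ {k} {c : Fin (suc (suc k)) → Bool} {f : Fin (suc k) → Bool}
  → c (suc zero) ≡ true → BalancedAtB (suc k) c f ⇔ BalancedAtB k (c ∘ suc) (f ∘ suc)
balancedAtB-drop {zero}  c₁ = mk⇔ (λ _ ()) (λ { _ zero zero () })
balancedAtB-drop {suc k} {c} {f} c₁ = mk⇔
  (λ bal → proj₂ (to (balancedAtB-step {k} {c} {f}) bal))
  (λ rest → from (balancedAtB-step {k} {c} {f})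
                 ((λ c₁≡false → contradiction (trans (sym c₁) c₁≡false) λ ()) , rest))

pair-weight : ∀ {b b'} → (b ≡ true → b' ≡ true → ⊥) → w b +ᶻ w b' ≡ + (2 * emptyPair b b')
pair-weight {true}  {true}  nd = ⊥-elim (nd refl refl)
pair-weight {true}  {false} _  = refl
pair-weight {false} {true}  _  = refl
pair-weight {false} {false} _  = refl

pair-balanced : ∀ {b b'} → (b ≡ true → b' ≡ true → ⊥)
  → (b2n b + b2n b' ≡ 1) ⇔ (emptyPair b b' ≡ 0)
pair-balanced {true}  {true}  nd = ⊥-elim (nd refl refl)
pair-balanced {true}  {false} _  = mk⇔ (λ _ → refl) (λ _ → refl)
pair-balanced {false} {true}  _  = mk⇔ (λ _ → refl) (λ _ → refl)
pair-balanced {false} {false} _  = mk⇔ (λ ()) (λ ())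

+≡0⇔ : ∀ {m n} → m + n ≡ 0 ⇔ (m ≡ 0 × n ≡ 0)
+≡0⇔ {m} = mk⇔ (λ m+n≡0 → m+n≡0⇒m≡0 m m+n≡0 , m+n≡0⇒n≡0 m m+n≡0) (λ { (refl , refl) → refl })

pos-2*-+ : ∀ m n → + (2 * m) +ᶻ + (2 * n) ≡ + (2 * (m + n))
pos-2*-+ m n = trans (sym (ℤ.pos-+ (2 * m) (2 * n))) (cong +_ (sym (*-distribˡ-+ 2 m n)))

module FirstPairFromA {k} {c : Fin (suc (suc (suc k))) → Bool} {f : Fin (suc (suc k)) → Bool}
  (c₀ : c zero ≡ true) (alt : Alternating (suc (suc k)) c) (nd : NoDoubleAtB (suc (suc k)) c f) where

  restC : Fin (suc k) → Bool
  restC i = c (suc (suc i))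

  restF : Fin k → Bool
  restF i = f (suc (suc i))

  c₁ : c (suc zero) ≡ false
  c₁ = trans (alt zero) (cong not c₀)

  c₂ : restC zero ≡ true
  c₂ = trans (alt (suc zero)) (cong not c₁)

  pair : f zero ≡ true → f (suc zero) ≡ true → ⊥
  pair = nd zero (suc zero) refl c₁

  alt₂ : Alternating k restC
  alt₂ = alternating-tail {c = c ∘ suc} (alternating-tail {c = c} alt)

  nd₂ : NoDoubleAtB k restC restF
  nd₂ = noDoubleAtB-tail {c = c ∘ suc} {f = f ∘ suc} (noDoubleAtB-tail {c = c} {f = f} nd)

  p : ℕ
  p = emptyPair (f zero) (f (suc zero))

  weight-peel : weightSeq (suc (suc k)) f ≡ + (2 * p) +ᶻ weightSeq k restF
  weight-peel = trans (sym (ℤ.+-assoc (w (f zero)) (w (f (suc zero))) (weightSeq k restF)))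
                      (cong (_+ᶻ weightSeq k restF) (pair-weight pair))

balanced⇔noEmptyPairs : ∀ k (c : Fin (suc k) → Bool) (f : Fin k → Bool)
  → c zero ≡ true → Alternating k c → NoDoubleAtB k c f
  → BalancedAtB k c f ⇔ emptyPairs k f ≡ 0
balanced⇔noEmptyPairs zero          _ _ _  _   _  = mk⇔ (λ _ → refl) (λ _ ())
balanced⇔noEmptyPairs (suc zero)    _ _ _  _   _  = mk⇔ (λ _ → refl) (λ { _ zero zero () })
balanced⇔noEmptyPairs (suc (suc k)) c f c₀ alt nd =
  ⇔-trans (balancedAtB-step {k} {c} {f}) (⇔-trans (first-pair ×-⇔ rest) (⇔-sym +≡0⇔))
  where
  open FirstPairFromA {c = c} {f = f} c₀ alt nd

  rest : BalancedAtB (suc k) (c ∘ suc) (f ∘ suc) ⇔ emptyPairs k restF ≡ 0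
  rest = ⇔-trans (balancedAtB-drop {c = c ∘ suc} {f = f ∘ suc} c₂)
                 (balanced⇔noEmptyPairs k restC restF c₂ alt₂ nd₂)

  first-pair : (c (suc zero) ≡ false → b2n (f zero) + b2n (f (suc zero)) ≡ 1) ⇔ (p ≡ 0)
  first-pair = ⇔-trans (mk⇔ (λ bal → bal c₁) (λ bal _ → bal)) (pair-balanced pair)

weight-even : ∀ k (c : Fin (suc k) → Bool) (f : Fin k → Bool)
  → c zero ≡ true → c (fromℕ k) ≡ true → Alternating k c → NoDoubleAtB k c f
  → weightSeq k f ≡ + (2 * emptyPairs k f)
weight-even zero          _ _ _  _  _   _  = refl
weight-even (suc zero)    _ _ c₀ c₁ alt _  =
  contradiction (trans (sym c₁) (trans (alt zero) (cong not c₀))) λ ()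
weight-even (suc (suc k)) c f c₀ cₗ alt nd = begin
  weightSeq (suc (suc k)) f               ≡⟨ weight-peel ⟩
  + (2 * p) +ᶻ weightSeq k restF          ≡⟨ cong (+ (2 * p) +ᶻ_) (weight-even k restC restF c₂ cₗ alt₂ nd₂) ⟩
  + (2 * p) +ᶻ + (2 * emptyPairs k restF) ≡⟨ pos-2*-+ p _ ⟩
  + (2 * emptyPairs (suc (suc k)) f)      ∎
  where
  open FirstPairFromA {c = c} {f = f} c₀ alt nd
  open ≡-Reasoning

weight-odd : ∀ k (c : Fin (suc (suc k)) → Bool) (f : Fin (suc k) → Bool)
  → c zero ≡ true → c (fromℕ (suc k)) ≡ false → Alternating (suc k) c → NoDoubleAtB (suc k) c f
  → weightSeq (suc k) f ≡ + (2 * emptyPairs (suc k) f) +ᶻ w (f (fromℕ k))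
weight-odd zero          _ f _ _ _ _ = trans (ℤ.+-identityʳ (w (f zero))) (sym (ℤ.+-identityˡ (w (f zero))))
weight-odd (suc zero)    c f c₀ cₗ alt nd = contradiction (trans (sym c₂) cₗ) λ ()
  where open FirstPairFromA {c = c} {f = f} c₀ alt nd
weight-odd (suc (suc k)) c f c₀ cₗ alt nd = begin
  weightSeq (suc (suc (suc k))) f                   ≡⟨ weight-peel ⟩
  + (2 * p) +ᶻ weightSeq (suc k) restF              ≡⟨ cong (+ (2 * p) +ᶻ_) (weight-odd k restC restF c₂ cₗ alt₂ nd₂) ⟩
  + (2 * p) +ᶻ (+ (2 * e) +ᶻ last)                  ≡⟨ ℤ.+-assoc (+ (2 * p)) (+ (2 * e)) last ⟨
  (+ (2 * p) +ᶻ + (2 * e)) +ᶻ last                  ≡⟨ cong (_+ᶻ last) (pos-2*-+ p e) ⟩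
  + (2 * emptyPairs (suc (suc (suc k))) f) +ᶻ last  ∎
  where
  open FirstPairFromA {c = c} {f = f} c₀ alt nd
  open ≡-Reasoning
  e : ℕ
  e = emptyPairs (suc k) restF
  last : ℤ
  last = w (f (fromℕ (suc (suc k))))

w-cases : ∀ s → w s ≡ + 1 ⊎ w s ≡ -[1+ 0 ]
w-cases true  = inj₂ refl
w-cases false = inj₁ refl

w≡+1⇔ : ∀ s → (w s ≡ + 1) ⇔ (s ≡ false)
w≡+1⇔ true  = mk⇔ (λ ()) (λ ())
w≡+1⇔ false = mk⇔ (λ _ → refl) (λ _ → refl)

w≡-1⇔ : ∀ s → (w s ≡ -[1+ 0 ]) ⇔ (s ≡ true)
w≡-1⇔ true  = mk⇔ (λ _ → refl) (λ _ → refl)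
w≡-1⇔ false = mk⇔ (λ ()) (λ ())

ends-cases : ∀ t s → w t +ᶻ w s ≡ -[1+ 1 ] ⊎ w t +ᶻ w s ≡ + 0 ⊎ w t +ᶻ w s ≡ + 2
ends-cases true  true  = inj₁ refl
ends-cases true  false = inj₂ (inj₁ refl)
ends-cases false true  = inj₂ (inj₁ refl)
ends-cases false false = inj₂ (inj₂ refl)

ends≡-2⇔ : ∀ t s → (w t +ᶻ w s ≡ -[1+ 1 ]) ⇔ (t ≡ true × s ≡ true)
ends≡-2⇔ true  true  = mk⇔ (λ _ → refl , refl) (λ _ → refl)
ends≡-2⇔ true  false = mk⇔ (λ ()) (λ ())
ends≡-2⇔ false true  = mk⇔ (λ ()) (λ ())
ends≡-2⇔ false false = mk⇔ (λ ()) (λ ())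

ends≡0⇔ : ∀ t s → (w t +ᶻ w s ≡ + 0) ⇔ ((t ≡ true × s ≡ false) ⊎ (t ≡ false × s ≡ true))
ends≡0⇔ true  true  = mk⇔ (λ ()) (λ { (inj₁ (_ , ())) ; (inj₂ (() , _)) })
ends≡0⇔ true  false = mk⇔ (λ _ → inj₁ (refl , refl)) (λ _ → refl)
ends≡0⇔ false true  = mk⇔ (λ _ → inj₂ (refl , refl)) (λ _ → refl)
ends≡0⇔ false false = mk⇔ (λ ()) (λ { (inj₁ (() , _)) ; (inj₂ (_ , ())) })

ends≡2⇔ : ∀ t s → (w t +ᶻ w s ≡ + 2) ⇔ (t ≡ false × s ≡ false)
ends≡2⇔ true  true  = mk⇔ (λ ()) (λ ())
ends≡2⇔ true  false = mk⇔ (λ ()) (λ ())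
ends≡2⇔ false true  = mk⇔ (λ ()) (λ ())
ends≡2⇔ false false = mk⇔ (λ _ → refl , refl) (λ _ → refl)

oneEnd≡-1 : ∀ e s → + (2 * e) +ᶻ w s ≡ -[1+ 0 ] → e ≡ 0
oneEnd≡-1 zero    _     _  = refl
oneEnd≡-1 (suc e) true  ()
oneEnd≡-1 (suc e) false ()

twoEnds≡-2 : ∀ t e s → w t +ᶻ (+ (2 * e) +ᶻ w s) ≡ -[1+ 1 ] → e ≡ 0
twoEnds≡-2 _ zero    _ _    = refl
twoEnds≡-2 t (suc e) s W≡-2 =
  ⊥-elim (nonNegative t s (subst (λ n → w t +ᶻ (+ n +ᶻ w s) ≡ -[1+ 1 ]) (*-suc 2 e) W≡-2))
  where
  nonNegative : ∀ t s → w t +ᶻ (+ (2 + 2 * e) +ᶻ w s) ≢ -[1+ 1 ]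
  nonNegative true  true  ()
  nonNegative true  false ()
  nonNegative false true  ()
  nonNegative false false ()

≡-⇔ : ∀ {x y v : ℤ} → x ≡ y → (x ≡ v) ⇔ (y ≡ v)
≡-⇔ x≡y = mk⇔ (trans (sym x≡y)) (trans x≡y)

weight-cases-oneEnd : ∀ {W : ℤ} {e : ℕ} {s : Bool} {Bal : Set} {Last : Bool → Set}
  → W ≡ + (2 * e) +ᶻ w s → (Bal ⇔ e ≡ 0) → (∀ b → Last b ⇔ s ≡ b)
  → (Bal → (W ≡ + 1 ⊎ W ≡ -[1+ 0 ]))
    × ((W ≡ -[1+ 0 ]) ⇔ (Bal × Last true))
    × (Bal → ((W ≡ + 1) ⇔ Last false))
weight-cases-oneEnd {e = e} {s} {Bal} {Last} refl bal⇔ last⇔ =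
    (λ bal → Sum.map (trans (balanced bal)) (trans (balanced bal)) (w-cases s))
  , minusOne
  , (λ bal → ⇔-trans (≡-⇔ (balanced bal)) (⇔-trans (w≡+1⇔ s) (⇔-sym (last⇔ false))))
  where
  at-e≡0 : e ≡ 0 → + (2 * e) +ᶻ w s ≡ w s
  at-e≡0 e≡0 = trans (cong (λ e → + (2 * e) +ᶻ w s) e≡0) (ℤ.+-identityˡ (w s))

  balanced : Bal → + (2 * e) +ᶻ w s ≡ w s
  balanced = at-e≡0 ∘ to bal⇔

  minusOne : (+ (2 * e) +ᶻ w s ≡ -[1+ 0 ]) ⇔ (Bal × Last true)
  minusOne = mk⇔
    (λ W≡-1 → let e≡0 = oneEnd≡-1 e s W≡-1 in
       from bal⇔ e≡0 , from (last⇔ true) (to (w≡-1⇔ s) (trans (sym (at-e≡0 e≡0)) W≡-1)))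
    (λ (bal , last) → trans (balanced bal) (from (w≡-1⇔ s) (to (last⇔ true) last)))

weight-cases-twoEnds : ∀ {W : ℤ} {t : Bool} {e : ℕ} {s : Bool} {Bal : Set} {First Last : Bool → Set}
  → W ≡ w t +ᶻ (+ (2 * e) +ᶻ w s) → (Bal ⇔ e ≡ 0)
  → (∀ b → First b ⇔ t ≡ b) → (∀ b → Last b ⇔ s ≡ b)
  → (Bal → (W ≡ -[1+ 1 ] ⊎ W ≡ + 0 ⊎ W ≡ + 2))
    × ((W ≡ -[1+ 1 ]) ⇔ (Bal × First true × Last true))
    × (Bal → ((W ≡ + 0) ⇔ ((First true × Last false) ⊎ (First false × Last true)))
           × ((W ≡ + 2) ⇔ (First false × Last false)))
weight-cases-twoEnds {t = t} {e} {s} {Bal} {First} {Last} refl bal⇔ first⇔ last⇔ =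
    (λ bal → subst (λ W → W ≡ -[1+ 1 ] ⊎ W ≡ + 0 ⊎ W ≡ + 2) (sym (balanced bal)) (ends-cases t s))
  , minusTwo
  , (λ bal → ⇔-trans (≡-⇔ (balanced bal))
                (⇔-trans (ends≡0⇔ t s)
                         ((first⇐ true ×-⇔ last⇐ false) ⊎-⇔ (first⇐ false ×-⇔ last⇐ true)))
           , ⇔-trans (≡-⇔ (balanced bal)) (⇔-trans (ends≡2⇔ t s) (first⇐ false ×-⇔ last⇐ false)))
  where
  first⇐ : ∀ b → (t ≡ b) ⇔ First b
  first⇐ b = ⇔-sym (first⇔ b)

  last⇐ : ∀ b → (s ≡ b) ⇔ Last b
  last⇐ b = ⇔-sym (last⇔ b)

  at-e≡0 : e ≡ 0 → w t +ᶻ (+ (2 * e) +ᶻ w s) ≡ w t +ᶻ w s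
  at-e≡0 e≡0 = trans (cong (λ e → w t +ᶻ (+ (2 * e) +ᶻ w s)) e≡0) (cong (w t +ᶻ_) (ℤ.+-identityˡ (w s)))

  balanced : Bal → w t +ᶻ (+ (2 * e) +ᶻ w s) ≡ w t +ᶻ w s
  balanced = at-e≡0 ∘ to bal⇔

  minusTwo : (w t +ᶻ (+ (2 * e) +ᶻ w s) ≡ -[1+ 1 ]) ⇔ (Bal × First true × Last true)
  minusTwo = mk⇔
    (λ W≡-2 → let e≡0 = twoEnds≡-2 t e s W≡-2
                  (t≡true , s≡true) = to (ends≡-2⇔ t s) (trans (sym (at-e≡0 e≡0)) W≡-2)
              in from bal⇔ e≡0 , from (first⇔ true) t≡true , from (last⇔ true) s≡true)
    (λ (bal , first , last) →
       trans (balanced bal) (from (ends≡-2⇔ t s) (to (first⇔ true) first , to (last⇔ true) last)))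

fromA-toA : ∀ k (c : Fin (suc k) → Bool) (f : Fin k → Bool)
  → c zero ≡ true → c (fromℕ k) ≡ true → Alternating k c → NoDoubleAtB k c f
  → BalancedAtB k c f ⇔ (weightSeq k f ≡ + 0)
fromA-toA k c f c₀ cₗ alt nd = ⇔-trans (balanced⇔noEmptyPairs k c f c₀ alt nd) (mk⇔
  (λ e≡0 → trans W≡ (cong (λ e → + (2 * e)) e≡0))
  (λ W≡0 → m+n≡0⇒m≡0 (emptyPairs k f) (ℤ.+-injective (trans (sym W≡) W≡0))))
  where
  W≡ : weightSeq k f ≡ + (2 * emptyPairs k f)
  W≡ = weight-even k c f c₀ cₗ alt nd

fromA-toB : ∀ k (c : Fin (suc k) → Bool) (f : Fin k → Bool)
  → c zero ≡ true → c (fromℕ k) ≡ false → Alternating k c → NoDoubleAtB k c f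
  → (BalancedAtB k c f → (weightSeq k f ≡ + 1 ⊎ weightSeq k f ≡ -[1+ 0 ]))
    × ((weightSeq k f ≡ -[1+ 0 ]) ⇔ (BalancedAtB k c f × LastIs k f true))
    × (BalancedAtB k c f → ((weightSeq k f ≡ + 1) ⇔ LastIs k f false))
fromA-toB zero    _ _ c₀ cₗ _   _  = contradiction (trans (sym c₀) cₗ) λ ()
fromA-toB (suc k) c f c₀ cₗ alt nd = weight-cases-oneEnd
  (weight-odd k c f c₀ cₗ alt nd) (balanced⇔noEmptyPairs (suc k) c f c₀ alt nd) (lastIs⇔ k f)

fromB-toB : ∀ k (c : Fin (suc k) → Bool) (f : Fin k → Bool)
  → c zero ≡ false → c (fromℕ k) ≡ false → k ≢ 0 → Alternating k c → NoDoubleAtB k c f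
  → (BalancedAtB k c f → (weightSeq k f ≡ -[1+ 1 ] ⊎ weightSeq k f ≡ + 0 ⊎ weightSeq k f ≡ + 2))
    × ((weightSeq k f ≡ -[1+ 1 ]) ⇔ (BalancedAtB k c f × FirstIs k f true × LastIs k f true))
    × (BalancedAtB k c f
       → ((weightSeq k f ≡ + 0)
            ⇔ ((FirstIs k f true × LastIs k f false) ⊎ (FirstIs k f false × LastIs k f true)))
         × ((weightSeq k f ≡ + 2) ⇔ (FirstIs k f false × LastIs k f false)))
fromB-toB zero                  _ _ _  _  k≢0 _   _  = contradiction refl k≢0
fromB-toB (suc zero)            _ _ c₀ cₗ _   alt _  =
  contradiction (trans (sym cₗ) (trans (alt zero) (cong not c₀))) λ ()
fromB-toB (suc (suc k)) c     f c₀ cₗ _   alt nd = weight-cases-twoEnds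
  (cong (w (f zero) +ᶻ_) (weight-odd k (c ∘ suc) (f ∘ suc) c₁ cₗ alt₁ nd₁))
  (⇔-trans (balancedAtB-drop {c = c} {f = f} c₁)
           (balanced⇔noEmptyPairs (suc k) (c ∘ suc) (f ∘ suc) c₁ alt₁ nd₁))
  (firstIs⇔ f) (lastIs⇔ (suc k) f)
  where
  c₁ : c (suc zero) ≡ true
  c₁ = trans (alt zero) (cong not c₀)
  alt₁ : Alternating (suc k) (c ∘ suc)
  alt₁ = alternating-tail {c = c} alt
  nd₁ : NoDoubleAtB (suc k) (c ∘ suc) (f ∘ suc)
  nd₁ = noDoubleAtB-tail {c = c} {f = f} nd

-- Minimum joins of a quasicomb

module _ (Γ : BipGraft) where
  open BipGraft Γ

  bEnd aEnd : Fin m → Fin n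
  bEnd e = if inA (proj₁ (ends e)) then proj₂ (ends e) else proj₁ (ends e)
  aEnd e = if inA (proj₁ (ends e)) then proj₁ (ends e) else proj₂ (ends e)

  link-alternates : ∀ e {u v} → (ends e ≡ (u , v)) ⊎ (ends e ≡ (v , u)) → inA v ≡ not (inA u)
  link-alternates e (inj₁ refl) = ¬-not (bipartite e ∘ sym)
  link-alternates e (inj₂ refl) = ¬-not (bipartite e)

  ends-of-link : ∀ e {u v} → (ends e ≡ (u , v)) ⊎ (ends e ≡ (v , u)) → inA u ≡ false
    → bEnd e ≡ u × aEnd e ≡ v
  ends-of-link e (inj₁ eq) u∈B rewrite eq | u∈B = refl , refl
  ends-of-link e {u} {v} (inj₂ eq) u∈B
    rewrite eq | trans (link-alternates e (inj₂ eq)) (cong not u∈B) = refl , refl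

  -- Equal to the F-degree for v ∈ B, and 0 for v ∈ A.
  bDeg : Subset m → Fin n → ℕ
  bDeg F v = count m (λ e → lookup F e ∧ does (v ≟ bEnd e))

  colours-differ : ∀ {u v} → inA u ≡ false → inA v ≡ true → u ≢ v
  colours-differ u∈B v∈A u≡v = contradiction (trans (sym u∈B) (trans (cong inA u≡v) v∈A)) λ ()

  incident-inB : ∀ {v} e → inA v ≡ false → incident Γ v e ≡ does (v ≟ bEnd e)
  incident-inB {v} e v∈B with inA (proj₁ (ends e)) in e₁∈A
  ... | true  rewrite dec-false (v ≟ proj₁ (ends e)) (colours-differ v∈B e₁∈A) = refl
  ... | false rewrite dec-false (v ≟ proj₂ (ends e))
                        (colours-differ v∈B (trans (link-alternates e (inj₁ refl)) (cong not e₁∈A)))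
                      = ∨-identityʳ _

  bDeg≡degIn : ∀ F {v} → inA v ≡ false → bDeg F v ≡ degIn Γ F v
  bDeg≡degIn F {v} v∈B = count-cong m λ e →
    trans (∧-comm (lookup F e) _) (cong (_∧ lookup F e) (sym (incident-inB e v∈B)))

  sum-bDeg : ∀ F → sum (bDeg F) ≡ size Γ F
  sum-bDeg F = sum-count-fibres bEnd (lookup F)

  |B∩T|≤bDeg : ∀ F → IsJoin Γ F → ∀ v → b2n (not (inA v) ∧ lookup T v) ≤ bDeg F v
  |B∩T|≤bDeg F join v with inA v in v∈A | lookup T v in v∈T
  ... | true  | _     = z≤n
  ... | false | false = z≤n
  ... | false | true  = subst (1 ≤_) (sym (bDeg≡degIn F v∈A)) (odd⇒positive _ (proj₂ (join v) v∈T))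
    where
    odd⇒positive : ∀ d → d % 2 ≡ 1 → 1 ≤ d
    odd⇒positive (suc d) _ = s≤s z≤n

  join-size>|B∩T| : ∀ F → IsJoin Γ F → ∀ v → 2 ≤ bDeg F v → sizeBT Γ < size Γ F
  join-size>|B∩T| F join v 2≤bDeg = begin-strict
    sizeBT Γ                                    ≡⟨ count≡sum n _ ⟩
    sum (λ u → b2n (not (inA u) ∧ lookup T u)) <⟨ sum-mono-< (|B∩T|≤bDeg F join) v (≤-<-trans (b2n≤1 _) 2≤bDeg) ⟩
    sum (bDeg F)                                 ≡⟨ sum-bDeg F ⟩
    size Γ F                                    ∎
    where
    open ≤-Reasoning
    b2n≤1 : ∀ b → b2n b ≤ 1
    b2n≤1 true  = s≤s z≤n
    b2n≤1 false = z≤n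

  minJoin-size≤|B∩T| : Quasicomb Γ → ∀ F → IsMinJoin Γ F → size Γ F ≤ sizeBT Γ
  minJoin-size≤|B∩T| ((F₀ , F₀-join , |F₀|≡) , _) F (_ , minimal) =
    subst (size Γ F ≤_) |F₀|≡ (minimal F₀ F₀-join)

  minJoin-bEnd-injective : Quasicomb Γ → ∀ F → IsMinJoin Γ F
    → ∀ {e e'} → lookup F e ≡ true → lookup F e' ≡ true → bEnd e ≡ bEnd e' → e ≡ e'
  minJoin-bEnd-injective Q F minJoin {e} {e'} e∈F e'∈F same with e ≟ e'
  ... | yes e≡e' = e≡e'
  ... | no  e≢e' = contradiction (minJoin-size≤|B∩T| Q F minJoin)
                                 (<⇒≱ (join-size>|B∩T| F (proj₁ minJoin) (bEnd e) two))
    where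
    two : 2 ≤ bDeg F (bEnd e)
    two = count-two m _ e e' e≢e' (cong₂ _∧_ e∈F (dec-true (bEnd e ≟ bEnd e) refl))
                                  (cong₂ _∧_ e'∈F (dec-true (bEnd e ≟ bEnd e') same))

module _ {Γ : BipGraft} {x y : Fin (BipGraft.n Γ)} (P : Path Γ x y) where
  open BipGraft Γ
  open Path P

  colours : Fin (suc len) → Bool
  colours v = inA (vs v)

  colour-first : ∀ {b} → inA x ≡ b → colours zero ≡ b
  colour-first = trans (cong inA start)

  colour-last : ∀ {b} → inA y ≡ b → colours (fromℕ len) ≡ b
  colour-last = trans (cong inA (stop (fromℕ len) (toℕ-fromℕ len)))

  distinct-ends⇒len≢0 : x ≢ y → len ≢ 0
  distinct-ends⇒len≢0 x≢y len≡0 = x≢y (trans (sym start) (stop zero (sym len≡0)))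

  path-alternating : Alternating len colours
  path-alternating i = link-alternates Γ (es i) (link i)

  path-noDoubleAtB : Quasicomb Γ → ∀ F → IsMinJoin Γ F → NoDoubleAtB len colours (λ i → lookup F (es i))
  path-noDoubleAtB Q F minJoin i j j≡1+i mid∈B i∈F j∈F =
    m≢1+n+m (toℕ i) (trans (sym (toℕ-inject₁ i)) (trans (cong toℕ (vsInj sameAEnd)) (cong suc j≡1+i)))
    where
    j-next : inject₁ j ≡ suc i
    j-next = toℕ-injective (trans (toℕ-inject₁ j) j≡1+i)

    ends-i : bEnd Γ (es i) ≡ vs (suc i) × aEnd Γ (es i) ≡ vs (inject₁ i)
    ends-i = ends-of-link Γ (es i) (Sum.swap (link i)) mid∈B

    ends-j : bEnd Γ (es j) ≡ vs (inject₁ j) × aEnd Γ (es j) ≡ vs (suc j)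
    ends-j = ends-of-link Γ (es j) (link j) (subst (λ u → inA (vs u) ≡ false) (sym j-next) mid∈B)

    sameEdge : es i ≡ es j
    sameEdge = minJoin-bEnd-injective Γ Q F minJoin i∈F j∈F
      (trans (proj₁ ends-i) (trans (cong vs (sym j-next)) (sym (proj₁ ends-j))))

    sameAEnd : vs (inject₁ i) ≡ vs (suc j)
    sameAEnd = trans (sym (proj₂ ends-i)) (trans (cong (aEnd Γ) sameEdge) (proj₂ ends-j))

lemma7p7 : (Γ : BipGraft) → Quasicomb Γ
    → (F : Subset (BipGraft.m Γ)) → IsMinJoin Γ F
    → (x y : Fin (BipGraft.n Γ)) → (P : Path Γ x y)
    → -- (i) x, y ∈ A
      ((BipGraft.inA Γ x ≡ true → BipGraft.inA Γ y ≡ true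
         → (Balanced Γ F P ⇔ (weight Γ F P ≡ + 0)))
    × -- (ii) x ∈ A, y ∈ B
      (BipGraft.inA Γ x ≡ true → BipGraft.inA Γ y ≡ false
         → (Balanced Γ F P → (weight Γ F P ≡ + 1 ⊎ weight Γ F P ≡ -[1+ 0 ]))
         × ((weight Γ F P ≡ -[1+ 0 ]) ⇔ (Balanced Γ F P × LastEdgeIs Γ F P true))
         × (Balanced Γ F P → ((weight Γ F P ≡ + 1) ⇔ LastEdgeIs Γ F P false)))
    × -- (iii) x, y ∈ B (with x ≠ y, so that P has end edges)
      (BipGraft.inA Γ x ≡ false → BipGraft.inA Γ y ≡ false → x ≢ y
         → (Balanced Γ F P → (weight Γ F P ≡ -[1+ 1 ] ⊎ weight Γ F P ≡ + 0
                               ⊎ weight Γ F P ≡ + 2))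
         × ((weight Γ F P ≡ -[1+ 1 ])
              ⇔ (Balanced Γ F P × FirstEdgeIs Γ F P true × LastEdgeIs Γ F P true))
         × (Balanced Γ F P
              → ((weight Γ F P ≡ + 0)
                   ⇔ ((FirstEdgeIs Γ F P true × LastEdgeIs Γ F P false)
                      ⊎ (FirstEdgeIs Γ F P false × LastEdgeIs Γ F P true)))
              × ((weight Γ F P ≡ + 2)
                   ⇔ (FirstEdgeIs Γ F P false × LastEdgeIs Γ F P false)))))
lemma7p7 Γ Q F minJoin x y P =
    (λ x∈A y∈A → fromA-toA len (colours P) marks (colour-first P x∈A) (colour-last P y∈A) alt noDouble)
  , (λ x∈A y∈B → fromA-toB len (colours P) marks (colour-first P x∈A) (colour-last P y∈B) alt noDouble)
  , (λ x∈B y∈B x≢y → fromB-toB len (colours P) marks (colour-first P x∈B) (colour-last P y∈B)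
                                (distinct-ends⇒len≢0 P x≢y) alt noDouble)
  where
  open Path P

  marks : Fin len → Bool
  marks i = lookup F (es i)

  alt : Alternating len (colours P)
  alt = path-alternating P

  noDouble : NoDoubleAtB len (colours P) marks
  noDouble = path-noDoubleAtB P Q F minJoin
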